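{- Let $p$ be a prime, $n\ge1$, $F=\mathbb{F}_{p^n}$, and let $f\colon F\to F$ be a nonzero function with $d^\circ(f)\le p$. Then for all $a,x,y\in F$, $$\tilde D_af(x\pm y)=\tilde D_af(x)\pm\tilde D_af(y)\mp\tilde D_af(0).$$ In particular, if $\tilde D_af(0)=0$, then the map $\tilde D_af\colon F\to F$ is $\mathbb{F}_p$-linear.
   Context: $\tilde D_af(x)=\sum_{j\in\mathbb{F}_p}f(x+ja)$. For $m\ge1$, $[f]^m(x_1,\dots,x_m)=\sum_{I\subseteq\{1,\dots,m\}}(-1)^{m-|I|}f\big(\sum_{k\in I}x_k\big)$ (empty sum $=0$), $[f]^0=f(0)$; for nonzero $f$, $d^\circ(f)$ is the largest $m\ge0$ with $[f]^m\not\equiv0$. -}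

module Defs where

open import Data.Nat using (ℕ; zero; suc; _<_; NonZero)
import Data.Nat as ℕ
open import Data.Nat.DivMod using (_mod_)
open import Data.Nat.Primality using (Prime; prime⇒nonZero)
open import Data.Fin using (Fin; toℕ)
open import Data.Vec using (Vec; []; _∷_; zipWith; map; replicate; allFin; foldr′)
open import Data.Product using (∃; _×_)
open import Relation.Binary.PropositionalEquality using (_≡_)
open import Relation.Nullary using (¬_)

-- The finite field F = 𝔽_{p^n}, as far as its additive / 𝔽_p-vector-space
-- structure is concerned (the only structure the statement uses),
-- modelled as 𝔽_p^n = Vec (Fin p) n, with 𝔽_p = Fin p (arithmetic mod p).
module FiniteField (p : ℕ) (pr : Prime p) (n : ℕ) where

  private instance
    p≢0 : NonZero p
    p≢0 = prime⇒nonZero pr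

  Fp : Set
  Fp = Fin p

  _+ₚ_ : Fp → Fp → Fp
  a +ₚ b = (toℕ a ℕ.+ toℕ b) mod p

  _*ₚ_ : Fp → Fp → Fp
  a *ₚ b = (toℕ a ℕ.* toℕ b) mod p

  -ₚ_ : Fp → Fp
  -ₚ a = (p ℕ.∸ toℕ a) mod p

  0ₚ : Fp
  0ₚ = 0 mod p

  F : Set
  F = Vec Fp n

  _+_ : F → F → F
  _+_ = zipWith _+ₚ_

  -_ : F → F
  - x = map -ₚ_ x

  _-_ : F → F → F
  x - y = x + (- y)

  0F : F
  0F = replicate n 0ₚ

  _·_ : Fp → F → F
  j · x = map (j *ₚ_) x

  infixl 6 _+_ _-_
  infixr 7 _·_

  Σ𝔽ₚ : (Fp → F) → F
  Σ𝔽ₚ g = foldr′ (λ j acc → g j + acc) 0F (allFin p)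

  D̃ : F → (F → F) → F → F
  D̃ a f x = Σ𝔽ₚ (λ j → f (x + j · a))

  -- alt f s (x₁,…,x_m) = Σ_{I ⊆ {1..m}} (-1)^{m-|I|} f (s + Σ_{k∈I} x_k),
  -- enumerated element by element: x_k is either included (sign +)
  -- or excluded (sign -).
  alt : (F → F) → F → {m : ℕ} → Vec F m → F
  alt f s []       = f s
  alt f s (x ∷ xs) = alt f (s + x) xs - alt f s xs

  bracket : (F → F) → {m : ℕ} → Vec F m → F
  bracket f xs = alt f 0F xs

  NonZeroFun : (F → F) → Set
  NonZeroFun f = ∃ λ x → ¬ (f x ≡ 0F)

  -- d°(f) ≤ d : the largest m with [f]^m ≢ 0 is ≤ d, i.e.
  -- [f]^m ≡ 0 for every m > d.
  DegLe : (F → F) → ℕ → Set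
  DegLe f d = ∀ (m : ℕ) → d < m → ∀ (xs : Vec F m) → bracket f xs ≡ 0F

  IsFpLinear : (F → F) → Set
  IsFpLinear g = (∀ x y → g (x + y) ≡ g x + g y) × (∀ (c : Fp) x → g (c · x) ≡ c · g x)

module Submission where

-- Write Δ^j f(s) = alt f s (a, …, a) (j copies) for the j-th difference of f
-- in direction a.  The proof combines two facts.
--  (1) The hockey-stick identity  Σ_{k<m} f(s + k a) = Σ_{j<m} C(m, j+1) Δ^j f(s),
--      proved by induction on m with Pascal's rule (orbit-sum).  For m = p the
--      prime p divides C(p, j+1) for j < p - 1 and F has characteristic p, so
--      only the top term survives:  D̃_a f = Δ^{p-1} f  (D̃-is-Δ).
--  (2) By definition [f]^{p+1}(x, y, a, …, a) is the second difference
--      (D(x+y) - D x) - (D y - D 0) of D = Δ^{p-1} f, which vanishes since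
--      d°(f) ≤ p.  A self-map of an abelian group with vanishing second
--      difference obeys the "x ± y" rules, and when it fixes 0 it is additive,
--      hence commutes with ℕ-multiples; as j · x is the (toℕ j)-fold sum of x,
--      this is 𝔽_p-linearity (AffineMaps).

open import Defs
open import Algebra.Bundles using (AbelianGroup)
open import Algebra.Consequences.Propositional using (comm∧idʳ⇒id; comm∧invʳ⇒inv)
open import Level using (0ℓ)
open import Data.Nat as ℕ using (ℕ; zero; suc; _<_; _≥_; s≤s)
import Data.Nat.Properties as ℕₚ
open import Data.Nat.DivMod using (_%_; _mod_; %-distribˡ-+; m%n%n≡m%n; m<n⇒m%n≡m; n%n≡0; m*n%n≡0)
open import Data.Nat.Divisibility using (_∣_; divides; ∣⇒≤)
open import Data.Nat.Primality using (Prime; euclidsLemma)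
open import Data.Product using (_×_; _,_)
open import Data.Fin as Fin using (Fin; toℕ; inject₁; fromℕ)
open import Data.Fin.Properties using (toℕ-injective; toℕ-fromℕ<; toℕ<n; toℕ-inject₁; toℕ-fromℕ)
open import Data.Vec using (Vec; []; _∷_; zipWith; map; replicate; tabulate; foldr′)
open import Data.Vec.Properties using (map-const; map-cong)
open import Data.Vec.Relation.Binary.Pointwise.Inductive using (Pointwise-≡⇒≡; zipWith-assoc; zipWith-comm; zipWith-identityʳ)
open import Data.Sum using (inj₁; inj₂)
open import Data.Empty using (⊥-elim)
open import Function using (id)
open import Relation.Binary.PropositionalEquality using (_≡_; refl; sym; trans; cong; cong₂; module ≡-Reasoning)
open import Relation.Binary.PropositionalEquality.Algebra using (isMagma)

module Binomial where
  open import Data.Nat using (_+_; _*_)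
  open ℕₚ using (*-zeroʳ; *-identityˡ; *-distribˡ-+; *-comm; <⇒≱; m<n⇒m<1+n; n<1+n)

  choose : ℕ → ℕ → ℕ
  choose _       zero    = 1
  choose zero    (suc k) = 0
  choose (suc m) (suc k) = choose m k + choose m (suc k)

  choose-above : ∀ m k → m < k → choose m k ≡ 0
  choose-above zero    (suc k) _         = refl
  choose-above (suc m) (suc k) (s≤s m<k) =
    cong₂ _+_ (choose-above m k m<k) (choose-above m (suc k) (m<n⇒m<1+n m<k))

  choose-diag : ∀ m → choose m m ≡ 1
  choose-diag zero    = refl
  choose-diag (suc m) = cong₂ _+_ (choose-diag m) (choose-above m (suc m) (n<1+n m))

  choose-absorb : ∀ m k → suc k * choose (suc m) (suc k) ≡ suc m * choose m k
  choose-absorb zero    zero    = refl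
  choose-absorb zero    (suc k) = *-zeroʳ (suc (suc k))
  choose-absorb (suc m) zero    =
    trans (*-identityˡ _) (cong (1 +_) (trans (sym (*-identityˡ _)) (choose-absorb m zero)))
  choose-absorb (suc m) (suc k) = begin
    (2 + k) * (c₁ + c₂)                ≡⟨ *-distribˡ-+ (2 + k) c₁ c₂ ⟩
    (c₁ + (1 + k) * c₁) + (2 + k) * c₂ ≡⟨ ℕₚ.+-assoc c₁ _ _ ⟩
    c₁ + ((1 + k) * c₁ + (2 + k) * c₂) ≡⟨ cong (c₁ +_) (cong₂ _+_ (choose-absorb m k) (choose-absorb m (suc k))) ⟩
    c₁ + ((1 + m) * b₁ + (1 + m) * b₂) ≡⟨ cong (c₁ +_) (sym (*-distribˡ-+ (1 + m) b₁ b₂)) ⟩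
    (2 + m) * c₁                       ∎
    where
      open ≡-Reasoning
      b₁ = choose m k
      b₂ = choose m (suc k)
      c₁ = choose (suc m) (suc k)
      c₂ = choose (suc m) (suc (suc k))

  prime∣choose : ∀ {q} → Prime (suc q) → ∀ k → suc k < suc q → suc q ∣ choose (suc q) (suc k)
  prime∣choose {q} pr k k<p
    with euclidsLemma (suc k) (choose (suc q) (suc k)) pr
           (divides (choose q k) (trans (choose-absorb q k) (*-comm (suc q) (choose q k))))
  ... | inj₁ p∣k+1 = ⊥-elim (<⇒≱ k<p (∣⇒≤ p∣k+1))
  ... | inj₂ p∣C   = p∣C

open Binomial

module AffineMaps {c ℓ} (G : AbelianGroup c ℓ) where
  open AbelianGroup G hiding (refl; sym; trans)
  open import Algebra.Properties.AbelianGroup G using (x∙y⁻¹≈ε⇒x≈y; ε⁻¹≈ε)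
  open import Algebra.Properties.Monoid monoid using (insertʳ; cancelʳ)
  open import Algebra.Properties.CommutativeSemigroup commutativeSemigroup using (xy∙z≈zx∙y; xy∙z≈xz∙y)
  open import Algebra.Definitions.RawMonoid rawMonoid using () renaming (_×_ to _×ₙ_)
  open import Relation.Binary.Reasoning.Setoid setoid

  add-difference : ∀ x y → y ≈ x ∙ (y ∙ x ⁻¹)
  add-difference x y = begin
    y                 ≈⟨ insertʳ (inverseˡ x) y ⟩
    (y ∙ x ⁻¹) ∙ x    ≈⟨ comm _ x ⟩
    x ∙ (y ∙ x ⁻¹)    ∎

  Δ² : (Carrier → Carrier) → Carrier → Carrier → Carrier
  Δ² D x y = (D (x ∙ y) ∙ D x ⁻¹) ∙ (D y ∙ D ε ⁻¹) ⁻¹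

  Δ²-cong : ∀ {D E : Carrier → Carrier} → (∀ x → D x ≈ E x) → ∀ x y → Δ² D x y ≈ Δ² E x y
  Δ²-cong D≈E x y =
    ∙-cong (∙-cong (D≈E (x ∙ y)) (⁻¹-cong (D≈E x))) (⁻¹-cong (∙-cong (D≈E y) (⁻¹-cong (D≈E ε))))

  module _ (D : Carrier → Carrier) (D-cong : ∀ {x y} → x ≈ y → D x ≈ D y)
           (Δ²≈ε : ∀ x y → Δ² D x y ≈ ε)
           where

    plus-rule : ∀ x y → D (x ∙ y) ≈ (D x ∙ D y) ∙ D ε ⁻¹
    plus-rule x y = begin
      D (x ∙ y)                         ≈⟨ insertʳ (inverseˡ (D x)) (D (x ∙ y)) ⟩
      (D (x ∙ y) ∙ D x ⁻¹) ∙ D x        ≈⟨ ∙-congʳ (x∙y⁻¹≈ε⇒x≈y _ _ (Δ²≈ε x y)) ⟩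
      (D y ∙ D ε ⁻¹) ∙ D x              ≈⟨ xy∙z≈zx∙y (D y) (D ε ⁻¹) (D x) ⟩
      (D x ∙ D y) ∙ D ε ⁻¹              ∎

    -- D(x - y) = D x - D y + D 0, from the plus-rule at (x - y, y)
    minus-rule : ∀ x y → D (x ∙ y ⁻¹) ≈ (D x ∙ D y ⁻¹) ∙ D ε
    minus-rule x y = begin
      t                                                   ≈⟨ cancelʳ (inverseˡ (D ε)) t ⟨
      (t ∙ D ε ⁻¹) ∙ D ε                                  ≈⟨ ∙-congʳ (cancelʳ (inverseʳ (D y)) (t ∙ D ε ⁻¹)) ⟨
      (((t ∙ D ε ⁻¹) ∙ D y) ∙ D y ⁻¹) ∙ D ε               ≈⟨ ∙-congʳ (∙-congʳ (xy∙z≈xz∙y t (D y) (D ε ⁻¹))) ⟨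
      (((t ∙ D y) ∙ D ε ⁻¹) ∙ D y ⁻¹) ∙ D ε               ≈⟨ ∙-congʳ (∙-congʳ (plus-rule (x ∙ y ⁻¹) y)) ⟨
      (D ((x ∙ y ⁻¹) ∙ y) ∙ D y ⁻¹) ∙ D ε                 ≈⟨ ∙-congʳ (∙-congʳ (D-cong (insertʳ (inverseˡ y) x))) ⟨
      (D x ∙ D y ⁻¹) ∙ D ε                                ∎
      where t = D (x ∙ y ⁻¹)

    module _ (D-ε : D ε ≈ ε) where

      additive : ∀ x y → D (x ∙ y) ≈ D x ∙ D y
      additive x y = begin
        D (x ∙ y)              ≈⟨ plus-rule x y ⟩
        (D x ∙ D y) ∙ D ε ⁻¹   ≈⟨ ∙-congˡ (⁻¹-cong D-ε) ⟩
        (D x ∙ D y) ∙ ε ⁻¹     ≈⟨ ∙-congˡ ε⁻¹≈ε ⟩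
        (D x ∙ D y) ∙ ε        ≈⟨ identityʳ _ ⟩
        D x ∙ D y              ∎

      ×-homo : ∀ m x → D (m ×ₙ x) ≈ m ×ₙ D x
      ×-homo zero    x = D-ε
      ×-homo (suc m) x = begin
        D (x ∙ m ×ₙ x)    ≈⟨ additive x (m ×ₙ x) ⟩
        D x ∙ D (m ×ₙ x)  ≈⟨ ∙-congˡ (×-homo m x) ⟩
        D x ∙ m ×ₙ D x    ∎

module PrimeField (q : ℕ) (pr : Prime (suc q)) (n : ℕ) where
  open FiniteField (suc q) pr n using (Fp; _+ₚ_; -ₚ_; 0ₚ)
  open import Data.Nat using (_+_; _*_; _∸_)
  open ℕₚ using (+-comm; +-identityʳ; *-comm; <⇒≤; m+[n∸m]≡n)
  open ≡-Reasoning

  p : ℕ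
  p = suc q

  toℕ-mod : ∀ m → toℕ (m mod p) ≡ m % p
  toℕ-mod m = toℕ-fromℕ< _

  %-absorbˡ : ∀ m k → (m % p + k) % p ≡ (m + k) % p
  %-absorbˡ m k = begin
    (m % p + k) % p            ≡⟨ %-distribˡ-+ (m % p) k p ⟩
    (m % p % p + k % p) % p    ≡⟨ cong (λ t → (t + k % p) % p) (m%n%n≡m%n m p) ⟩
    (m % p + k % p) % p        ≡⟨ %-distribˡ-+ m k p ⟨
    (m + k) % p                ∎

  %-absorbʳ : ∀ k m → (k + m % p) % p ≡ (k + m) % p
  %-absorbʳ k m = begin
    (k + m % p) % p   ≡⟨ cong (_% p) (+-comm k (m % p)) ⟩
    (m % p + k) % p   ≡⟨ %-absorbˡ m k ⟩
    (m + k) % p       ≡⟨ cong (_% p) (+-comm m k) ⟩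
    (k + m) % p       ∎

  toℕ-+ₚ : ∀ a b → toℕ (a +ₚ b) ≡ (toℕ a + toℕ b) % p
  toℕ-+ₚ a b = toℕ-mod (toℕ a + toℕ b)

  +ₚ-assoc : ∀ a b c → (a +ₚ b) +ₚ c ≡ a +ₚ (b +ₚ c)
  +ₚ-assoc a b c = toℕ-injective (begin
    toℕ ((a +ₚ b) +ₚ c)                ≡⟨ toℕ-+ₚ (a +ₚ b) c ⟩
    (toℕ (a +ₚ b) + toℕ c) % p         ≡⟨ cong (λ t → (t + toℕ c) % p) (toℕ-+ₚ a b) ⟩
    ((toℕ a + toℕ b) % p + toℕ c) % p  ≡⟨ %-absorbˡ (toℕ a + toℕ b) (toℕ c) ⟩
    (toℕ a + toℕ b + toℕ c) % p        ≡⟨ cong (_% p) (ℕₚ.+-assoc (toℕ a) (toℕ b) (toℕ c)) ⟩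
    (toℕ a + (toℕ b + toℕ c)) % p      ≡⟨ %-absorbʳ (toℕ a) (toℕ b + toℕ c) ⟨
    (toℕ a + (toℕ b + toℕ c) % p) % p  ≡⟨ cong (λ t → (toℕ a + t) % p) (toℕ-+ₚ b c) ⟨
    (toℕ a + toℕ (b +ₚ c)) % p         ≡⟨ toℕ-+ₚ a (b +ₚ c) ⟨
    toℕ (a +ₚ (b +ₚ c))                ∎)

  +ₚ-comm : ∀ a b → a +ₚ b ≡ b +ₚ a
  +ₚ-comm a b = cong (_mod p) (+-comm (toℕ a) (toℕ b))

  +ₚ-identityʳ : ∀ a → a +ₚ 0ₚ ≡ a
  +ₚ-identityʳ a = toℕ-injective (begin
    toℕ (a +ₚ 0ₚ)          ≡⟨ toℕ-+ₚ a 0ₚ ⟩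
    (toℕ a + 0 % p) % p    ≡⟨ %-absorbʳ (toℕ a) 0 ⟩
    (toℕ a + 0) % p        ≡⟨ cong (_% p) (+-identityʳ (toℕ a)) ⟩
    toℕ a % p              ≡⟨ m<n⇒m%n≡m (toℕ<n a) ⟩
    toℕ a                  ∎)

  +ₚ-inverseʳ : ∀ a → a +ₚ (-ₚ a) ≡ 0ₚ
  +ₚ-inverseʳ a = toℕ-injective (begin
    toℕ (a +ₚ (-ₚ a))                 ≡⟨ toℕ-+ₚ a (-ₚ a) ⟩
    (toℕ a + toℕ (-ₚ a)) % p          ≡⟨ cong (λ t → (toℕ a + t) % p) (toℕ-mod (p ∸ toℕ a)) ⟩
    (toℕ a + (p ∸ toℕ a) % p) % p     ≡⟨ %-absorbʳ (toℕ a) (p ∸ toℕ a) ⟩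
    (toℕ a + (p ∸ toℕ a)) % p         ≡⟨ cong (_% p) (m+[n∸m]≡n (<⇒≤ (toℕ<n a))) ⟩
    p % p                             ≡⟨ n%n≡0 p ⟩
    0                                 ∎)

  -- the ℕ-multiple m·b in 𝔽_p; note j *ₚ b is by definition mulₚ (toℕ j) b
  mulₚ : ℕ → Fp → Fp
  mulₚ m b = (m * toℕ b) mod p

  mulₚ-suc : ∀ m b → b +ₚ mulₚ m b ≡ mulₚ (suc m) b
  mulₚ-suc m b = toℕ-injective (begin
    toℕ (b +ₚ mulₚ m b)                ≡⟨ toℕ-+ₚ b (mulₚ m b) ⟩
    (toℕ b + toℕ (mulₚ m b)) % p       ≡⟨ cong (λ t → (toℕ b + t) % p) (toℕ-mod (m * toℕ b)) ⟩
    (toℕ b + (m * toℕ b) % p) % p      ≡⟨ %-absorbʳ (toℕ b) (m * toℕ b) ⟩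
    (toℕ b + m * toℕ b) % p            ≡⟨ toℕ-mod (suc m * toℕ b) ⟨
    toℕ (mulₚ (suc m) b)               ∎)

  mulₚ-p : ∀ b → mulₚ p b ≡ 0ₚ
  mulₚ-p b = toℕ-injective (begin
    toℕ (mulₚ p b)       ≡⟨ toℕ-mod (p * toℕ b) ⟩
    (p * toℕ b) % p      ≡⟨ cong (_% p) (*-comm p (toℕ b)) ⟩
    (toℕ b * p) % p      ≡⟨ m*n%n≡0 (toℕ b) p ⟩
    0                    ∎)

module Development (q : ℕ) (pr : Prime (suc q)) (n : ℕ) where
  open FiniteField (suc q) pr n
  open PrimeField q pr n
  open ≡-Reasoning

  +-assoc : ∀ (x y z : F) → (x + y) + z ≡ x + (y + z)
  +-assoc x y z = Pointwise-≡⇒≡ (zipWith-assoc +ₚ-assoc x y z)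

  +-comm : ∀ (x y : F) → x + y ≡ y + x
  +-comm x y = Pointwise-≡⇒≡ (zipWith-comm +ₚ-comm x y)

  +-identityʳ : ∀ (x : F) → x + 0F ≡ x
  +-identityʳ x = Pointwise-≡⇒≡ (zipWith-identityʳ +ₚ-identityʳ x)

  -- stated for vectors of any length so that it can be proved by induction
  +-inverseʳ : ∀ {k} (x : Vec Fp k) → zipWith _+ₚ_ x (map -ₚ_ x) ≡ replicate k 0ₚ
  +-inverseʳ []      = refl
  +-inverseʳ (a ∷ x) = cong₂ _∷_ (+ₚ-inverseʳ a) (+-inverseʳ x)

  F-abelianGroup : AbelianGroup 0ℓ 0ℓ
  F-abelianGroup = record
    { isAbelianGroup = record
      { isGroup = record
        { isMonoid = record
          { isSemigroup = record { isMagma = isMagma _+_ ; assoc = +-assoc }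
          ; identity    = comm∧idʳ⇒id +-comm +-identityʳ
          }
        ; inverse = comm∧invʳ⇒inv +-comm +-inverseʳ
        ; ⁻¹-cong = cong (λ x → - x)
        }
      ; comm = +-comm
      }
    }

  open AbelianGroup F-abelianGroup using (monoid; commutativeMonoid) renaming (identityˡ to +-identityˡ)
  open import Algebra.Properties.CommutativeMonoid.Mult commutativeMonoid
    using (×-homo-+; ×-homo-1; ×-assocˡ; ×-distrib-+) renaming (_×_ to _×ₙ_)
  open import Algebra.Properties.Monoid.Sum monoid using (sum; sum-cong-≗; sum-init-last; sum-replicate-zero)
  open import Algebra.Properties.CommutativeMonoid.Sum commutativeMonoid using (∑-distrib-+)

  ×ₙ-coordinatewise : ∀ m (v : F) → m ×ₙ v ≡ map (mulₚ m) v
  ×ₙ-coordinatewise zero    v = sym (map-const v 0ₚ)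
  ×ₙ-coordinatewise (suc m) v = trans (cong (v +_) (×ₙ-coordinatewise m v)) (step v)
    where
      step : ∀ {k} (v : Vec Fp k) → zipWith _+ₚ_ v (map (mulₚ m) v) ≡ map (mulₚ (suc m)) v
      step []      = refl
      step (b ∷ v) = cong₂ _∷_ (mulₚ-suc m b) (step v)

  ·-as-×ₙ : ∀ (j : Fp) (v : F) → j · v ≡ toℕ j ×ₙ v
  ·-as-×ₙ j v = sym (×ₙ-coordinatewise (toℕ j) v)

  p×ₙ≡0 : ∀ v → p ×ₙ v ≡ 0F
  p×ₙ≡0 v = begin
    p ×ₙ v                   ≡⟨ ×ₙ-coordinatewise p v ⟩
    map (mulₚ p) v           ≡⟨ map-cong mulₚ-p v ⟩
    map (λ _ → 0ₚ) v         ≡⟨ map-const v 0ₚ ⟩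
    0F                       ∎

  ∣⇒×ₙ≡0 : ∀ {m} v → p ∣ m → m ×ₙ v ≡ 0F
  ∣⇒×ₙ≡0 v (divides d refl) = begin
    (d ℕ.* p) ×ₙ v   ≡⟨ cong (_×ₙ v) (ℕₚ.*-comm d p) ⟩
    (p ℕ.* d) ×ₙ v   ≡⟨ ×-assocˡ v p d ⟨
    p ×ₙ (d ×ₙ v)    ≡⟨ p×ₙ≡0 (d ×ₙ v) ⟩
    0F               ∎

  Σ< : ℕ → (ℕ → F) → F
  Σ< m h = sum {m} (λ k → h (toℕ k))

  Σ<-snoc : ∀ m h → Σ< (suc m) h ≡ Σ< m h + h m
  Σ<-snoc m h = begin
    Σ< (suc m) h                                       ≡⟨ sum-init-last {m} (λ k → h (toℕ k)) ⟩
    sum {m} (λ k → h (toℕ (inject₁ k))) + h (toℕ (fromℕ m))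
                                                       ≡⟨ cong₂ _+_ (sum-cong-≗ {m} (λ k → cong h (toℕ-inject₁ k)))
                                                                    (cong h (toℕ-fromℕ m)) ⟩
    Σ< m h + h m                                       ∎

  Σ<-vanishing : ∀ m h → (∀ k → k < m → h k ≡ 0F) → Σ< m h ≡ 0F
  Σ<-vanishing m h zero-below = trans (sum-cong-≗ {m} (λ k → zero-below (toℕ k) (toℕ<n k))) (sum-replicate-zero m)

  Σ<-cong : ∀ m {h g : ℕ → F} → (∀ k → h k ≡ g k) → Σ< m h ≡ Σ< m g
  Σ<-cong m h≗g = sum-cong-≗ {m} (λ k → h≗g (toℕ k))

  Σ<-distrib : ∀ m (h g : ℕ → F) → Σ< m (λ k → h k + g k) ≡ Σ< m h + Σ< m g
  Σ<-distrib m h g = ∑-distrib-+ {m} (λ k → h (toℕ k)) (λ k → g (toℕ k))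

  pascal-sum : ∀ m (u : ℕ → F) →
    Σ< (suc m) (λ j → choose (suc m) (suc j) ×ₙ u j)
      ≡ (u 0 + Σ< m (λ j → choose m (suc j) ×ₙ u (suc j))) + Σ< m (λ j → choose m (suc j) ×ₙ u j)
  pascal-sum m u = begin
    Σ< (suc m) (λ j → choose (suc m) (suc j) ×ₙ u j)
      ≡⟨ Σ<-cong (suc m) (λ j → ×-homo-+ (u j) (choose m j) (choose m (suc j))) ⟩
    Σ< (suc m) (λ j → choose m j ×ₙ u j + choose m (suc j) ×ₙ u j)
      ≡⟨ Σ<-distrib (suc m) (λ j → choose m j ×ₙ u j) (λ j → choose m (suc j) ×ₙ u j) ⟩
    (1 ×ₙ u 0 + B) + Σ< (suc m) (λ j → choose m (suc j) ×ₙ u j)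
      ≡⟨ cong₂ _+_ (cong (_+ B) (×-homo-1 (u 0))) (Σ<-snoc m (λ j → choose m (suc j) ×ₙ u j)) ⟩
    (u 0 + B) + (A + choose m (suc m) ×ₙ u m)
      ≡⟨ cong (λ c → (u 0 + B) + (A + c ×ₙ u m)) (choose-above m (suc m) (ℕₚ.n<1+n m)) ⟩
    (u 0 + B) + (A + 0F)
      ≡⟨ cong ((u 0 + B) +_) (+-identityʳ A) ⟩
    (u 0 + B) + A ∎
    where
      A = Σ< m (λ j → choose m (suc j) ×ₙ u j)
      B = Σ< m (λ j → choose m (suc j) ×ₙ u (suc j))

  Σ𝔽ₚ-as-sum : ∀ (g : Fp → F) → Σ𝔽ₚ g ≡ sum {p} g
  Σ𝔽ₚ-as-sum g = fold-tabulate id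
    where
      fold-tabulate : ∀ {N} (φ : Fin N → Fp) →
        foldr′ (λ j acc → g j + acc) 0F (tabulate φ) ≡ sum {N} (λ k → g (φ k))
      fold-tabulate {zero}  φ = refl
      fold-tabulate {suc N} φ = cong (g (φ Fin.zero) +_) (fold-tabulate (λ k → φ (Fin.suc k)))

  open AffineMaps F-abelianGroup using (add-difference; Δ²; Δ²-cong; plus-rule; minus-rule; additive; ×-homo)

  bracket-as-Δ² : ∀ (f : F → F) x y {m} (r : Vec F m) → bracket f (x ∷ y ∷ r) ≡ Δ² (λ s → alt f s r) x y
  bracket-as-Δ² f x y r =
    cong₂ (λ u v → (alt f (u + y) r - alt f u r) - (alt f v r - alt f 0F r)) (+-identityˡ x) (+-identityˡ y)

  module Orbit (f : F → F) (a : F) where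

    Δ : ℕ → F → F
    Δ j s = alt f s (replicate j a)

    Δ-shift : ∀ j s → Δ j (s + a) ≡ Δ j s + Δ (suc j) s
    Δ-shift j s = add-difference (Δ j s) (Δ j (s + a))

    orbit-sum : ∀ m s → Σ< m (λ k → f (s + k ×ₙ a)) ≡ Σ< m (λ j → choose m (suc j) ×ₙ Δ j s)
    orbit-sum zero    s = refl
    orbit-sum (suc m) s = begin
      f (s + 0F) + Σ< m (λ k → f (s + (a + k ×ₙ a)))
        ≡⟨ cong₂ _+_ (cong f (+-identityʳ s)) (Σ<-cong m (λ k → cong f (sym (+-assoc s a (k ×ₙ a))))) ⟩
      f s + Σ< m (λ k → f ((s + a) + k ×ₙ a))
        ≡⟨ cong (f s +_) (orbit-sum m (s + a)) ⟩
      f s + Σ< m (λ j → C j ×ₙ Δ j (s + a))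
        ≡⟨ cong (f s +_) (Σ<-cong m (λ j → trans (cong (C j ×ₙ_) (Δ-shift j s)) (×-distrib-+ (Δ j s) (Δ (suc j) s) (C j)))) ⟩
      f s + Σ< m (λ j → C j ×ₙ Δ j s + C j ×ₙ Δ (suc j) s)
        ≡⟨ cong (f s +_) (Σ<-distrib m (λ j → C j ×ₙ Δ j s) (λ j → C j ×ₙ Δ (suc j) s)) ⟩
      f s + (A + B)
        ≡⟨ cong (f s +_) (+-comm A B) ⟩
      f s + (B + A)
        ≡⟨ +-assoc (f s) B A ⟨
      (f s + B) + A
        ≡⟨ pascal-sum m (λ j → Δ j s) ⟨
      Σ< (suc m) (λ j → choose (suc m) (suc j) ×ₙ Δ j s) ∎
      where
        C : ℕ → ℕ
        C j = choose m (suc j)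
        A = Σ< m (λ j → C j ×ₙ Δ j s)
        B = Σ< m (λ j → C j ×ₙ Δ (suc j) s)

    -- In characteristic p all weights C(p, j+1), j < p - 1, vanish, so
    -- the orbit sum D̃_a f is the (p-1)-st difference.
    D̃-is-Δ : ∀ s → D̃ a f s ≡ Δ q s
    D̃-is-Δ s = begin
      D̃ a f s
        ≡⟨ Σ𝔽ₚ-as-sum (λ j → f (s + j · a)) ⟩
      sum {p} (λ j → f (s + j · a))
        ≡⟨ sum-cong-≗ {p} (λ j → cong (λ t → f (s + t)) (·-as-×ₙ j a)) ⟩
      Σ< p (λ k → f (s + k ×ₙ a))
        ≡⟨ orbit-sum p s ⟩
      Σ< p (λ j → choose p (suc j) ×ₙ Δ j s)
        ≡⟨ Σ<-snoc q (λ j → choose p (suc j) ×ₙ Δ j s) ⟩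
      Σ< q (λ j → choose p (suc j) ×ₙ Δ j s) + choose p p ×ₙ Δ q s
        ≡⟨ cong₂ _+_ (Σ<-vanishing q _ (λ j j<q → ∣⇒×ₙ≡0 (Δ j s) (prime∣choose pr j (s≤s j<q))))
                     (cong (_×ₙ Δ q s) (choose-diag p)) ⟩
      0F + 1 ×ₙ Δ q s
        ≡⟨ +-identityˡ _ ⟩
      1 ×ₙ Δ q s
        ≡⟨ ×-homo-1 (Δ q s) ⟩
      Δ q s ∎

  affine-orbit-sums : (f : F → F) → NonZeroFun f → DegLe f p →
    ((a x y : F) →
       (D̃ a f (x + y) ≡ D̃ a f x + D̃ a f y - D̃ a f 0F)
       × (D̃ a f (x - y) ≡ D̃ a f x - D̃ a f y + D̃ a f 0F))
    × ((a : F) → D̃ a f 0F ≡ 0F → IsFpLinear (D̃ a f))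
  affine-orbit-sums f _ deg =
    (λ a x y → plus-rule (D̃ a f) (cong (D̃ a f)) (Δ²-D̃ a) x y , minus-rule (D̃ a f) (cong (D̃ a f)) (Δ²-D̃ a) x y) ,
    λ a D̃0≡0 → additive (D̃ a f) (cong (D̃ a f)) (Δ²-D̃ a) D̃0≡0 , scalar a D̃0≡0
    where
      -- degree ≤ p kills the bracket of order p + 1 = 2 + (p - 1)
      Δ²-D̃ : ∀ a x y → Δ² (D̃ a f) x y ≡ 0F
      Δ²-D̃ a x y = begin
        Δ² (D̃ a f) x y                        ≡⟨ Δ²-cong (Orbit.D̃-is-Δ f a) x y ⟩
        Δ² (Orbit.Δ f a q) x y                 ≡⟨ bracket-as-Δ² f x y (replicate q a) ⟨
        bracket f (x ∷ y ∷ replicate q a)      ≡⟨ deg (suc p) (ℕₚ.n<1+n p) (x ∷ y ∷ replicate q a) ⟩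
        0F                                     ∎

      scalar : ∀ a → D̃ a f 0F ≡ 0F → ∀ (j : Fp) x → D̃ a f (j · x) ≡ j · D̃ a f x
      scalar a D̃0≡0 j x = begin
        D̃ a f (j · x)          ≡⟨ cong (D̃ a f) (·-as-×ₙ j x) ⟩
        D̃ a f (toℕ j ×ₙ x)     ≡⟨ ×-homo (D̃ a f) (cong (D̃ a f)) (Δ²-D̃ a) D̃0≡0 (toℕ j) x ⟩
        toℕ j ×ₙ D̃ a f x       ≡⟨ ·-as-×ₙ j (D̃ a f x) ⟨
        j · D̃ a f x            ∎

proposition2p9 : (p : ℕ) (pr : Prime p) (n : ℕ) → n ≥ 1 →
    let open FiniteField p pr n in
    (f : F → F) → NonZeroFun f → DegLe f p →
    ((a x y : F) →
       (D̃ a f (x + y) ≡ D̃ a f x + D̃ a f y - D̃ a f 0F)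
       × (D̃ a f (x - y) ≡ D̃ a f x - D̃ a f y + D̃ a f 0F))
    × ((a : F) → D̃ a f 0F ≡ 0F → IsFpLinear (D̃ a f))
-- p = 0 is not prime
proposition2p9 zero    ()
proposition2p9 (suc q) pr n _ = Development.affine-orbit-sums q pr n
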